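{- Consider the following statements. (C1) If $\mathcal{F}$ is a finite union-closed family of sets with $\emptyset\notin\mathcal{F}$, then some element belongs to more than half of the sets of $\mathcal{F}$. (C1') If $\mathcal{F}$ is a finite union-closed family of sets with $\mathcal{F}\neq\{\emptyset\}$, then some element belongs to at least half of the sets of $\mathcal{F}$. (C2) If $\mathcal{F}$ is a finite union-closed family of sets with $\emptyset\notin\mathcal{F}$ and precisely one element belongs to more than half of the sets of $\mathcal{F}$, then this element belongs to every set of $\mathcal{F}$. (C2') If $\mathcal{F}$ is a finite union-closed family of sets and precisely one element belongs to at least half of the sets of $\mathcal{F}$, then this element belongs to every non-empty set of $\mathcal{F}$. (C3) If $\mathcal{F}$ is a finite union-closed twin-free family of sets with $\emptyset\notin\mathcal{F}$, $M$ is the largest set of $\mathcal{F}$, and precisely one element $x$ belongs to more than half of the sets of $\mathcal{F}$, then $\mathcal{F}$ is exactly the family of all subsets of $M$ containing $x$. (C3') Let $\mathcal{F}$ be a finite union-closed family of sets with largest set $M$, such that for every pair of elements $a,b$ of $M$ there is $A\in\mathcal{F}$ with $|A\cap\{a,b\}|=1$, and such that $x$ is the only element belonging to at least half of the sets of $\mathcal{F}$. If $|M|\geq 2$, then $\mathcal{F}$ consists of the empty set together with exactly all subsets of $M$ containing $x$; if $|M|=1$, then $\mathcal{F}=\{\{x\}\}$ or $\mathcal{F}=\{\emptyset,\{x\}\}$. (C4) If $\mathcal{F}$ is a finite union-closed family of sets whose smallest set has size at least $2$, then there are at least two elements each of which belongs to more than half of the sets of $\mathcal{F}$. (C4') If $\mathcal{F}$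 is a finite union-closed family of sets with $\mathcal{F}\neq\{\emptyset\}$ whose smallest non-empty set has size at least $2$, then there are at least two elements each of which belongs to at least half of the sets of $\mathcal{F}$. Then (C1) is equivalent to (C1'), (C2) is equivalent to (C2'), (C3) is equivalent to (C3'), and (C4) is equivalent to (C4').
   Context: A family of sets is a collection of pairwise distinct sets; it is union-closed if the union of any two of its sets belongs to it. Two elements $a,b$ are twins in $\mathcal{F}$ if every $A\in\mathcal{F}$ satisfies $|A\cap\{a,b\}|\neq 1$; $\mathcal{F}$ is twin-free if it has no twins. -}

module Defs where

open import Data.Nat using (ℕ; _*_; _<_; _≤_)
open import Data.Fin using (Fin)
open import Data.Fin.Subset using (Subset; _∈_; _∉_; _⊆_; _∪_; ⊥; ⁅_⁆; ∣_∣)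
open import Data.Fin.Subset.Properties using (_∈?_)
open import Data.List using (List; []; _∷_; length; filter)
import Data.List.Membership.Propositional as LM
open import Data.List.Relation.Unary.Unique.Propositional using (Unique)
open import Data.Product using (Σ; _×_; ∃; ∃-syntax)
open import Data.Sum using (_⊎_)
open import Relation.Binary.PropositionalEquality using (_≡_; _≢_)
open import Relation.Nullary using (¬_)
open import Function.Bundles using (_⇔_)

-- A finite family of finite sets: a duplicate-free list of subsets of Fin n.
Family : ℕ → Set
Family n = List (Subset n)

_∈F_ : ∀ {n} → Subset n → Family n → Set
A ∈F F = A LM.∈ F

_∉F_ : ∀ {n} → Subset n → Family n → Set
A ∉F F = ¬ (A ∈F F)

-- a family of sets: pairwise distinct and (by convention) non-empty
IsFamily : ∀ {n} → Family n → Set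
IsFamily F = Unique F × F ≢ []

UnionClosed : ∀ {n} → Family n → Set
UnionClosed F = ∀ A B → A ∈F F → B ∈F F → (A ∪ B) ∈F F

deg : ∀ {n} → Fin n → Family n → ℕ
deg x F = length (filter (x ∈?_) F)

MoreThanHalf : ∀ {n} → Fin n → Family n → Set
MoreThanHalf x F = length F < 2 * deg x F

AtLeastHalf : ∀ {n} → Fin n → Family n → Set
AtLeastHalf x F = length F ≤ 2 * deg x F

Separates : ∀ {n} → Subset n → Fin n → Fin n → Set
Separates A a b = (a ∈ A × b ∉ A) ⊎ (a ∉ A × b ∈ A)

Twins : ∀ {n} → Family n → Fin n → Fin n → Set
Twins F a b = ∀ A → A ∈F F → ¬ Separates A a b

-- no two distinct elements of the ground set ⋃F are twins
TwinFree : ∀ {n} → Family n → Set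
TwinFree F = ∀ a b → a ≢ b →
  (∃[ A ] (A ∈F F × a ∈ A)) → (∃[ B ] (B ∈F F × b ∈ B)) → ¬ Twins F a b

Largest : ∀ {n} → Family n → Subset n → Set
Largest F M = M ∈F F × (∀ A → A ∈F F → A ⊆ M)

C1 : Set
C1 = ∀ n (F : Family n) → IsFamily F → UnionClosed F → ⊥ ∉F F →
  ∃[ x ] MoreThanHalf x F

C1' : Set
C1' = ∀ n (F : Family n) → IsFamily F → UnionClosed F → F ≢ ⊥ ∷ [] →
  ∃[ x ] AtLeastHalf x F

C2 : Set
C2 = ∀ n (F : Family n) → IsFamily F → UnionClosed F → ⊥ ∉F F →
  ∀ x → MoreThanHalf x F → (∀ y → MoreThanHalf y F → y ≡ x) →
  ∀ A → A ∈F F → x ∈ A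

C2' : Set
C2' = ∀ n (F : Family n) → IsFamily F → UnionClosed F →
  ∀ x → AtLeastHalf x F → (∀ y → AtLeastHalf y F → y ≡ x) →
  ∀ A → A ∈F F → A ≢ ⊥ → x ∈ A

C3 : Set
C3 = ∀ n (F : Family n) → IsFamily F → UnionClosed F → TwinFree F → ⊥ ∉F F →
  ∀ M → Largest F M →
  ∀ x → MoreThanHalf x F → (∀ y → MoreThanHalf y F → y ≡ x) →
  ∀ A → (A ∈F F ⇔ (A ⊆ M × x ∈ A))

C3' : Set
C3' = ∀ n (F : Family n) → IsFamily F → UnionClosed F →
  ∀ M → Largest F M →
  (∀ a b → a ∈ M → b ∈ M → a ≢ b → ∃[ A ] (A ∈F F × Separates A a b)) →
  ∀ x → AtLeastHalf x F → (∀ y → AtLeastHalf y F → y ≡ x) →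
  (2 ≤ ∣ M ∣ → ∀ A → (A ∈F F ⇔ (A ≡ ⊥ ⊎ (A ⊆ M × x ∈ A))))
  × (∣ M ∣ ≡ 1 →
      (∀ A → (A ∈F F ⇔ A ≡ ⁅ x ⁆))
      ⊎ (∀ A → (A ∈F F ⇔ (A ≡ ⊥ ⊎ A ≡ ⁅ x ⁆))))

C4 : Set
C4 = ∀ n (F : Family n) → IsFamily F → UnionClosed F →
  (∀ A → A ∈F F → 2 ≤ ∣ A ∣) →
  ∃[ a ] ∃[ b ] (a ≢ b × MoreThanHalf a F × MoreThanHalf b F)

C4' : Set
C4' = ∀ n (F : Family n) → IsFamily F → UnionClosed F → F ≢ ⊥ ∷ [] →
  (∀ A → A ∈F F → A ≢ ⊥ → 2 ≤ ∣ A ∣) →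
  ∃[ a ] ∃[ b ] (a ≢ b × AtLeastHalf a F × AtLeastHalf b F)

-- Adding ∅ to a family without it, or deleting ∅ from a family containing it, changes the
-- number of sets by one and no degree, so it turns "more than half" into "at least half" and
-- back; this already gives every implication except (C2) ⇒ (C2') and (C3) ⇒ (C3') for
-- families F without ∅.  For those, adjoin a new point 0 lying only in a new top set {0} ∪ M
-- (the sets of F are kept): an element of M in at least half of the sets of F is in more than
-- half of the sets of the extension, and 0, lying in one of |F| + 1 ≥ 2 sets, is not.  For
-- (C2) take M to be the whole ground set.  For (C3) take the largest set M: by (C3) the
-- extension then contains {0} ∪ A for each A ∈ F, which forces A = M, and so M = {x}.

module Submission where

open import Defs
open import Data.Product using (_×_; _,_; proj₁; proj₂; ∃-syntax; uncurry; map₂)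
open import Function.Bundles using (_⇔_; mk⇔; Equivalence)
open import Function using (_∘_)
open import Function.Construct.Composition using (_⇔-∘_)
open import Function.Construct.Identity using (⇔-id)
open import Function.Construct.Symmetry using (⇔-sym)
open import Data.Sum using (_⊎_; inj₁; inj₂)
open import Data.Empty using (⊥-elim)
open import Relation.Nullary using (¬_; Dec; does; yes; no; ¬?; contradiction)
open import Relation.Nullary.Decidable using (_×-dec_; _⊎-dec_)
open import Relation.Binary.Definitions using (DecidableEquality)
open import Relation.Binary.PropositionalEquality
  using (_≡_; _≢_; refl; sym; trans; cong; subst; subst₂; ≢-sym)
open import Data.Nat using (ℕ; zero; suc; _*_; _≤_; _<_; z≤n; s≤s)
open import Data.Nat.Properties
  using (≤-pred; <⇒≤; <-irrefl; ≤-reflexive; m≤n⇒m≤1+n; ≤-trans; *-suc; *-monoʳ-≤; m≤n*m)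
open import Data.Bool using (true; false)
open import Data.Bool.Properties using () renaming (_≟_ to _≟ᵇ_)
open import Data.Fin using (Fin; zero; suc)
open import Data.Fin.Properties using () renaming (_≟_ to _≟ᶠ_)
open import Data.Fin.Subset
open import Data.Fin.Subset.Properties
open import Data.Vec using (_∷_; here; there)
open import Data.Vec.Properties using (≡-dec; ∷-injectiveˡ; ∷-injectiveʳ)
open import Data.List using ([]; _∷_; length; filter; map)
open import Data.List.Properties using (filter-accept; filter-reject; filter-all; length-map)
open import Data.List.Membership.Propositional using (find; lose)
open import Data.List.Membership.Propositional.Properties using (∈-filter⁺; ∈-filter⁻; ∈-map⁺; ∈-map⁻)
open import Data.List.Relation.Unary.Any using (here; there; any?)
import Data.List.Relation.Unary.All as All
open import Data.List.Relation.Unary.All using (All)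
open import Data.List.Relation.Unary.AllPairs using (_∷_)
open import Data.List.Relation.Unary.Unique.Propositional using (Unique)
import Data.List.Relation.Unary.Unique.Propositional.Properties as Unique

private variable
  n : ℕ
  x y : Fin n
  A B M : Subset n
  F G : Family n

_≟ₛ_ : DecidableEquality (Subset n)
_≟ₛ_ = ≡-dec _≟ᵇ_

p∪q≡⊥⇒p≡⊥ : A ∪ B ≡ ⊥ → A ≡ ⊥
p∪q≡⊥⇒p≡⊥ {B = B} A∪B≡⊥ = ⊆-antisym (λ x∈A → subst (_ ∈_) A∪B≡⊥ (p⊆p∪q B x∈A)) ⊥⊆

p⊆q⇒p∪q≡q : A ⊆ B → A ∪ B ≡ B
p⊆q⇒p∪q≡q {A = A} {B} A⊆B = ⊆-antisym ∪⊆ (q⊆p∪q A B)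
  where
  ∪⊆ : A ∪ B ⊆ B
  ∪⊆ x∈A∪B with x∈p∪q⁻ A B x∈A∪B
  ... | inj₁ x∈A = A⊆B x∈A
  ... | inj₂ x∈B = x∈B

x∈p⇒⁅x⁆⊆p : x ∈ A → ⁅ x ⁆ ⊆ A
x∈p⇒⁅x⁆⊆p {x = x} x∈A y∈⁅x⁆ = subst (_∈ _) (sym (x∈⁅y⁆⇒x≡y x y∈⁅x⁆)) x∈A

x∈p⇒0<∣p∣ : x ∈ A → 0 < ∣ A ∣
x∈p⇒0<∣p∣ {x = x} x∈A = subst (_≤ _) (∣⁅x⁆∣≡1 x) (p⊆q⇒∣p∣≤∣q∣ (x∈p⇒⁅x⁆⊆p x∈A))

∣p∣≡1⇒≡ : ∣ A ∣ ≡ 1 → x ∈ A → y ∈ A → x ≡ y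
∣p∣≡1⇒≡ {A = A} {x = x} {y = y} ∣A∣≡1 x∈A y∈A with x ≟ᶠ y
... | yes x≡y = x≡y
... | no x≢y = contradiction (subst₂ _<_ (∣⁅x⁆∣≡1 x) ∣A∣≡1 (p⊂q⇒∣p∣<∣q∣ ⁅x⁆⊂A)) (<-irrefl refl)
  where
  ⁅x⁆⊂A : ⁅ x ⁆ ⊂ A
  ⁅x⁆⊂A = x∈p⇒⁅x⁆⊆p x∈A , y , y∈A , x≢y⇒x∉⁅y⁆ (≢-sym x≢y)

⊥≢⁅x⁆ : ⊥ ≢ ⁅ x ⁆
⊥≢⁅x⁆ {x = x} ⊥≡⁅x⁆ = ∉⊥ (subst (x ∈_) (sym ⊥≡⁅x⁆) (x∈⁅x⁆ x))

Principal : Subset n → Fin n → Subset n → Set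
Principal M x A = A ⊆ M × x ∈ A

principal⇔≡⁅x⁆ : ∣ M ∣ ≡ 1 → x ∈ M → Principal M x A ⇔ A ≡ ⁅ x ⁆
principal⇔≡⁅x⁆ {M = M} {x = x} {A = A} ∣M∣≡1 x∈M = mk⇔ to from
  where
  to : Principal M x A → A ≡ ⁅ x ⁆
  to (A⊆M , x∈A) =
    ⊆-antisym (λ y∈A → Equivalence.from x∈⁅y⁆⇔x≡y (∣p∣≡1⇒≡ ∣M∣≡1 (A⊆M y∈A) x∈M)) (x∈p⇒⁅x⁆⊆p x∈A)
  from : A ≡ ⁅ x ⁆ → Principal M x A
  from refl = x∈p⇒⁅x⁆⊆p x∈M , x∈⁅x⁆ x

Enumerates : Family n → (Subset n → Set) → Set
Enumerates F P = ∀ A → A ∈F F ⇔ P A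

deg-∷-∈ : y ∈ A → deg y (A ∷ F) ≡ suc (deg y F)
deg-∷-∈ {y = y} y∈A = cong length (filter-accept (y ∈?_) y∈A)

deg-∷-∉ : y ∉ A → deg y (A ∷ F) ≡ deg y F
deg-∷-∉ {y = y} y∉A = cong length (filter-reject (y ∈?_) y∉A)

∈-all⇒atLeastHalf : All (y ∈_) F → AtLeastHalf y F
∈-all⇒atLeastHalf {y = y} {F = F} y∈all =
  subst (λ d → length F ≤ 2 * d) (sym (cong length (filter-all (y ∈?_) y∈all))) (m≤n*m (length F) 2)

deg≢0⇒∃∈ : deg y F ≢ 0 → ∃[ A ] (A ∈F F × y ∈ A)
deg≢0⇒∃∈ {F = []} deg≢0 = ⊥-elim (deg≢0 refl)
deg≢0⇒∃∈ {y = y} {F = A ∷ F} deg≢0 with y ∈? A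
... | yes y∈A = A , here refl , y∈A
... | no y∉A with B , B∈F , y∈B ← deg≢0⇒∃∈ deg≢0 = B , there B∈F , y∈B

atLeastHalf⇒∈largest : F ≢ [] → Largest F M → AtLeastHalf y F → y ∈ M
atLeastHalf⇒∈largest {F = []} F≢[] _ _ = ⊥-elim (F≢[] refl)
atLeastHalf⇒∈largest {F = A ∷ F} {y = y} _ (_ , bounded) half =
  let B , B∈F , y∈B = deg≢0⇒∃∈ deg≢0 in bounded B B∈F y∈B
  where
  deg≢0 : deg y (A ∷ F) ≢ 0
  deg≢0 deg≡0 = contradiction (subst (λ d → suc (length F) ≤ 2 * d) deg≡0 half) λ ()

atLeastHalf⇔moreThanHalf : length F ≡ suc (length G) → deg y F ≡ deg y G →
  AtLeastHalf y F ⇔ MoreThanHalf y G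
atLeastHalf⇔moreThanHalf length≡ deg≡ rewrite length≡ | deg≡ = ⇔-id _

≤-double⇔suc<double-suc : ∀ l d → l ≤ 2 * d ⇔ suc l < 2 * suc d
≤-double⇔suc<double-suc l d rewrite *-suc 2 d = mk⇔ (s≤s ∘ s≤s) (≤-pred ∘ ≤-pred)

-- Adding the empty set

⊥∷-isFamily : IsFamily F → ⊥ ∉F F → IsFamily (⊥ ∷ F)
⊥∷-isFamily (unique , _) ⊥∉F = All.tabulate (λ { A∈F refl → ⊥∉F A∈F }) ∷ unique , λ ()

⊥∷-unionClosed : UnionClosed F → UnionClosed (⊥ ∷ F)
⊥∷-unionClosed uc A B (here refl) (here refl) = here (∪-idem ⊥)
⊥∷-unionClosed uc A B (here refl) (there B∈F) = there (subst (_∈F _) (sym (∪-identityˡ B)) B∈F)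
⊥∷-unionClosed uc A B (there A∈F) (here refl) = there (subst (_∈F _) (sym (∪-identityʳ A)) A∈F)
⊥∷-unionClosed uc A B (there A∈F) (there B∈F) = there (uc A B A∈F B∈F)

⊥∷-largest : Largest F M → Largest (⊥ ∷ F) M
⊥∷-largest (M∈F , bounded) = there M∈F , λ { A (here refl) → ⊥⊆ ; A (there A∈F) → bounded A A∈F }

atLeastHalf-⊥∷⇔moreThanHalf : ∀ y (F : Family n) → AtLeastHalf y (⊥ ∷ F) ⇔ MoreThanHalf y F
atLeastHalf-⊥∷⇔moreThanHalf y F =
  atLeastHalf⇔moreThanHalf {F = ⊥ ∷ F} {G = F} refl (deg-∷-∉ {y = y} {F = F} ∉⊥)

⊥∷-enumerates⁻ : {P : Subset n → Set} → ⊥ ∉F F → ¬ P ⊥ →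
  Enumerates (⊥ ∷ F) (λ A → A ≡ ⊥ ⊎ P A) → Enumerates F P
⊥∷-enumerates⁻ {F = F} {P = P} ⊥∉F ¬P⊥ char A = mk⇔ to from
  where
  to : A ∈F F → P A
  to A∈F with Equivalence.to (char A) (there A∈F)
  ... | inj₁ refl = contradiction A∈F ⊥∉F
  ... | inj₂ PA = PA
  from : P A → A ∈F F
  from PA with Equivalence.from (char A) (inj₂ PA)
  ... | here refl = contradiction PA ¬P⊥
  ... | there A∈F = A∈F

-- Removing the empty set

⊥∈F? : (F : Family n) → Dec (⊥ ∈F F)
⊥∈F? = any? (⊥ ≟ₛ_)

dropEmpty : Family n → Family n
dropEmpty = filter (λ A → ¬? (A ≟ₛ ⊥))

∈-dropEmpty⁺ : A ∈F F → A ≢ ⊥ → A ∈F dropEmpty F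
∈-dropEmpty⁺ = ∈-filter⁺ (λ A → ¬? (A ≟ₛ ⊥))

∈-dropEmpty⁻ : A ∈F dropEmpty F → A ∈F F × A ≢ ⊥
∈-dropEmpty⁻ {F = F} = ∈-filter⁻ (λ A → ¬? (A ≟ₛ ⊥)) {xs = F}

⊥∉dropEmpty : ⊥ ∉F dropEmpty F
⊥∉dropEmpty {F = F} ⊥∈ = proj₂ (∈-dropEmpty⁻ {F = F} ⊥∈) refl

dropEmpty-isFamily : IsFamily F → A ∈F F → A ≢ ⊥ → IsFamily (dropEmpty F)
dropEmpty-isFamily (unique , _) A∈F A≢⊥ =
  Unique.filter⁺ (λ A → ¬? (A ≟ₛ ⊥)) unique ,
  λ F′≡[] → contradiction (subst (_ ∈F_) F′≡[] (∈-dropEmpty⁺ A∈F A≢⊥)) λ ()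

dropEmpty-unionClosed : UnionClosed F → UnionClosed (dropEmpty F)
dropEmpty-unionClosed {F = F} uc A B A∈ B∈
  with A∈F , A≢⊥ ← ∈-dropEmpty⁻ {F = F} A∈ | B∈F , _ ← ∈-dropEmpty⁻ {F = F} B∈
  = ∈-dropEmpty⁺ (uc A B A∈F B∈F) (A≢⊥ ∘ p∪q≡⊥⇒p≡⊥)

dropEmpty-largest : Largest F M → M ≢ ⊥ → Largest (dropEmpty F) M
dropEmpty-largest {F = F} (M∈F , bounded) M≢⊥ =
  ∈-dropEmpty⁺ M∈F M≢⊥ , λ A A∈ → bounded A (proj₁ (∈-dropEmpty⁻ {F = F} A∈))

length-dropEmpty : Unique F → ⊥ ∈F F → length F ≡ suc (length (dropEmpty F))
length-dropEmpty {F = A ∷ F} (A∉F ∷ unique) ⊥∈ with A ≟ₛ ⊥ | ⊥∈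
... | yes refl | _ = cong suc (sym (cong length (filter-all _ (All.map ≢-sym A∉F))))
... | no A≢⊥ | here ⊥≡A = contradiction (sym ⊥≡A) A≢⊥
... | no A≢⊥ | there ⊥∈F = cong suc (length-dropEmpty unique ⊥∈F)

deg-dropEmpty : ∀ y (F : Family n) → deg y (dropEmpty F) ≡ deg y F
deg-dropEmpty y [] = refl
deg-dropEmpty y (A ∷ F) with A ≟ₛ ⊥
... | yes refl = trans (deg-dropEmpty y F) (sym (deg-∷-∉ {y = y} {F = F} ∉⊥))
... | no _ with y ∈? A
...   | yes _ = cong suc (deg-dropEmpty y F)
...   | no _ = deg-dropEmpty y F

atLeastHalf⇔moreThanHalf-dropEmpty : Unique F → ⊥ ∈F F →
  ∀ y → AtLeastHalf y F ⇔ MoreThanHalf y (dropEmpty F)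
atLeastHalf⇔moreThanHalf-dropEmpty {F = F} unique ⊥∈F y =
  atLeastHalf⇔moreThanHalf {F = F} {G = dropEmpty F}
    (length-dropEmpty unique ⊥∈F) (sym (deg-dropEmpty y F))

dropEmpty-enumerates⁻ : {P : Subset n → Set} → ⊥ ∈F F →
  Enumerates (dropEmpty F) P → Enumerates F (λ A → A ≡ ⊥ ⊎ P A)
dropEmpty-enumerates⁻ {F = F} {P = P} ⊥∈F char A = mk⇔ to from
  where
  to : A ∈F F → A ≡ ⊥ ⊎ P A
  to A∈F with A ≟ₛ ⊥
  ... | yes A≡⊥ = inj₁ A≡⊥
  ... | no A≢⊥ = inj₂ (Equivalence.to (char A) (∈-dropEmpty⁺ A∈F A≢⊥))
  from : A ≡ ⊥ ⊎ P A → A ∈F F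
  from (inj₁ refl) = ⊥∈F
  from (inj₂ PA) = proj₁ (∈-dropEmpty⁻ {F = F} (Equivalence.from (char A) PA))

nonEmptyMember : IsFamily F → F ≢ ⊥ ∷ [] → ∃[ A ] (A ∈F F × A ≢ ⊥)
nonEmptyMember {F = []} (_ , F≢[]) _ = ⊥-elim (F≢[] refl)
nonEmptyMember {F = A ∷ F} _ _ with A ≟ₛ ⊥
nonEmptyMember {F = A ∷ F} _ _ | no A≢⊥ = A , here refl , A≢⊥
nonEmptyMember {F = A ∷ []} _ F≢⊥∷[] | yes refl = ⊥-elim (F≢⊥∷[] refl)
nonEmptyMember {F = A ∷ B ∷ F} ((⊥∉ ∷ _) , _) _ | yes refl = B , there (here refl) , ≢-sym (All.head ⊥∉)

-- Twin-freeness

PointSeparating : Family n → Subset n → Set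
PointSeparating F M = ∀ a b → a ∈ M → b ∈ M → a ≢ b → ∃[ A ] (A ∈F F × Separates A a b)

separates? : ∀ (A : Subset n) a b → Dec (Separates A a b)
separates? A a b = ((a ∈? A) ×-dec ¬? (b ∈? A)) ⊎-dec (¬? (a ∈? A) ×-dec (b ∈? A))

separates-∷ : ∀ s {a b} → Separates A a b → Separates (s ∷ A) (suc a) (suc b)
separates-∷ s (inj₁ (a∈A , b∉A)) = inj₁ (there a∈A , b∉A ∘ drop-there)
separates-∷ s (inj₂ (a∉A , b∈A)) = inj₂ (a∉A ∘ drop-there , there b∈A)

separates⇒≢⊥ : ∀ {a b} → Separates A a b → A ≢ ⊥
separates⇒≢⊥ (inj₁ (a∈A , _)) refl = ∉⊥ a∈A
separates⇒≢⊥ (inj₂ (_ , b∈A)) refl = ∉⊥ b∈A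

pointSeparating-mono : (∀ {A} → A ∈F F → A ≢ ⊥ → A ∈F G) → PointSeparating F M → PointSeparating G M
pointSeparating-mono F⊆G separating a b a∈M b∈M a≢b
  with A , A∈F , sep ← separating a b a∈M b∈M a≢b = A , F⊆G A∈F (separates⇒≢⊥ sep) , sep

pointSeparating⇒twinFree : (∀ A → A ∈F F → A ⊆ M) → PointSeparating F M → TwinFree F
pointSeparating⇒twinFree bounded separating a b a≢b (A , A∈F , a∈A) (B , B∈F , b∈B) twins
  with S , S∈F , sep ← separating a b (bounded A A∈F a∈A) (bounded B B∈F b∈B) a≢b = twins S S∈F sep

twinFree⇒pointSeparating : M ∈F F → TwinFree F → PointSeparating F M
twinFree⇒pointSeparating {M = M} {F = F} M∈F twinFree a b a∈M b∈M a≢b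
  with any? (λ S → separates? S a b) F
... | yes separated = find separated
... | no ¬separated =
  ⊥-elim (twinFree a b a≢b (M , M∈F , a∈M) (M , M∈F , b∈M) λ S S∈F → ¬separated ∘ lose S∈F)

-- Extension by a new point

extend : Subset n → Family n → Family (suc n)
extend M F = (inside ∷ M) ∷ map (outside ∷_) F

∈-extend⁺ : A ∈F F → (outside ∷ A) ∈F extend M F
∈-extend⁺ A∈F = there (∈-map⁺ (outside ∷_) A∈F)

∈-extend⁻ : {B : Subset (suc n)} → B ∈F extend M F → B ≡ inside ∷ M ⊎ ∃[ A ] (A ∈F F × B ≡ outside ∷ A)
∈-extend⁻ (here B≡) = inj₁ B≡
∈-extend⁻ (there B∈) = inj₂ (∈-map⁻ (outside ∷_) B∈)

extend-isFamily : Unique F → IsFamily (extend M F)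
extend-isFamily {F = F} {M = M} unique = All.tabulate top≢lifted ∷ Unique.map⁺ ∷-injectiveʳ unique , λ ()
  where
  top≢lifted : ∀ {B} → B ∈F map (outside ∷_) F → inside ∷ M ≢ B
  top≢lifted B∈ top≡B with _ , _ , refl ← ∈-map⁻ (outside ∷_) B∈ with () ← ∷-injectiveˡ top≡B

extend-unionClosed : UnionClosed F → (∀ A → A ∈F F → A ⊆ M) → UnionClosed (extend M F)
extend-unionClosed {F = F} {M = M} uc bounded X Y X∈ Y∈ with ∈-extend⁻ {F = F} X∈ | ∈-extend⁻ {F = F} Y∈
... | inj₁ refl | inj₁ refl = here (cong (inside ∷_) (∪-idem M))
... | inj₁ refl | inj₂ (B , B∈F , refl) =
  here (cong (inside ∷_) (trans (∪-comm M B) (p⊆q⇒p∪q≡q (bounded B B∈F))))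
... | inj₂ (A , A∈F , refl) | inj₁ refl = here (cong (inside ∷_) (p⊆q⇒p∪q≡q (bounded A A∈F)))
... | inj₂ (A , A∈F , refl) | inj₂ (B , B∈F , refl) = ∈-extend⁺ (uc A B A∈F B∈F)

⊥∉extend : ⊥ ∉F F → ⊥ ∉F extend M F
⊥∉extend {F = F} ⊥∉F ⊥∈ with ∈-extend⁻ {F = F} ⊥∈
... | inj₂ (A , A∈F , ⊥≡) = ⊥∉F (subst (_∈F F) (sym (∷-injectiveʳ ⊥≡)) A∈F)

extend-largest : (∀ A → A ∈F F → A ⊆ M) → Largest (extend M F) (inside ∷ M)
extend-largest {F = F} {M = M} bounded = here refl , λ B B∈ → ⊆top (∈-extend⁻ {F = F} B∈)
  where
  ⊆top : ∀ {B} → B ≡ inside ∷ M ⊎ ∃[ A ] (A ∈F F × B ≡ outside ∷ A) → B ⊆ inside ∷ M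
  ⊆top (inj₁ refl) = ⊆-refl
  ⊆top (inj₂ (A , A∈F , refl)) = out⊆ (bounded A A∈F)

pointSeparating-extend : M ∈F F → PointSeparating F M → PointSeparating (extend M F) (inside ∷ M)
pointSeparating-extend M∈F separating zero zero _ _ 0≢0 = contradiction refl 0≢0
pointSeparating-extend M∈F separating zero (suc b) _ (there b∈M) _ =
  outside ∷ _ , ∈-extend⁺ M∈F , inj₂ ((λ ()) , there b∈M)
pointSeparating-extend M∈F separating (suc a) zero (there a∈M) _ _ =
  outside ∷ _ , ∈-extend⁺ M∈F , inj₁ (there a∈M , λ ())
pointSeparating-extend M∈F separating (suc a) (suc b) (there a∈M) (there b∈M) a≢b
  with S , S∈F , sep ← separating a b a∈M b∈M (a≢b ∘ cong suc) =
  outside ∷ S , ∈-extend⁺ S∈F , separates-∷ outside sep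

extend-principal⇒≡ : ∀ {x : Fin n} → Enumerates (extend M F) (Principal (inside ∷ M) (suc x)) →
  A ∈F F → A ≡ M
extend-principal⇒≡ {M = M} {F = F} {A = A} char A∈F
  with A⊆M , sx∈A ← Equivalence.to (char (outside ∷ A)) (∈-extend⁺ A∈F)
  with ∈-extend⁻ {F = F}
         (Equivalence.from (char (inside ∷ A)) (s⊆s (drop-∷-⊆ A⊆M) , there (drop-there sx∈A)))
... | inj₁ top≡ = ∷-injectiveʳ top≡
... | inj₂ (_ , _ , lifted≡) with () ← ∷-injectiveˡ lifted≡

length-extend : ∀ M (F : Family n) → length (extend M F) ≡ suc (length F)
length-extend M F = cong suc (length-map (outside ∷_) F)

deg-zero-map-outside∷ : ∀ (F : Family n) → deg zero (map (outside ∷_) F) ≡ 0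
deg-zero-map-outside∷ [] = refl
deg-zero-map-outside∷ (A ∷ F) = deg-zero-map-outside∷ F

deg-zero-extend : ∀ M (F : Family n) → deg zero (extend M F) ≡ 1
deg-zero-extend M F = cong suc (deg-zero-map-outside∷ F)

deg-suc-map∷ : ∀ s y (F : Family n) → deg (suc y) (map (s ∷_) F) ≡ deg y F
deg-suc-map∷ s y [] = refl
deg-suc-map∷ s y (A ∷ F) with does (y ∈? A)
... | true = cong suc (deg-suc-map∷ s y F)
... | false = deg-suc-map∷ s y F

deg-suc-extend≤ : ∀ y M (F : Family n) → deg (suc y) (extend M F) ≤ suc (deg y F)
deg-suc-extend≤ y M F with does (y ∈? M)
... | true = s≤s (≤-reflexive (deg-suc-map∷ outside y F))
... | false = m≤n⇒m≤1+n (≤-reflexive (deg-suc-map∷ outside y F))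

atLeastHalf⇒moreThanHalf-extend : y ∈ M → AtLeastHalf y F → MoreThanHalf (suc y) (extend M F)
atLeastHalf⇒moreThanHalf-extend {y = y} {M = M} {F = F} y∈M half =
  subst₂ (λ l d → l < 2 * d) (sym (length-extend M F)) (sym deg≡)
    (Equivalence.to (≤-double⇔suc<double-suc (length F) (deg y F)) half)
  where
  deg≡ : deg (suc y) (extend M F) ≡ suc (deg y F)
  deg≡ = trans (deg-∷-∈ (there y∈M)) (cong suc (deg-suc-map∷ outside y F))

moreThanHalf-extend⇒atLeastHalf : MoreThanHalf (suc y) (extend M F) → AtLeastHalf y F
moreThanHalf-extend⇒atLeastHalf {y = y} {M = M} {F = F} more =
  Equivalence.from (≤-double⇔suc<double-suc (length F) (deg y F))
    (≤-trans (subst (λ l → l < 2 * deg (suc y) (extend M F)) (length-extend M F) more)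
             (*-monoʳ-≤ 2 (deg-suc-extend≤ y M F)))

¬moreThanHalf-zero-extend : F ≢ [] → ¬ MoreThanHalf zero (extend M F)
¬moreThanHalf-zero-extend {F = []} F≢[] _ = F≢[] refl
¬moreThanHalf-zero-extend {F = A ∷ F} {M = M} _ more =
  contradiction (subst₂ (λ l d → l < 2 * d) (length-extend M (A ∷ F)) (deg-zero-extend M (A ∷ F)) more)
    λ { (s≤s (s≤s ())) }

extend-onlyMoreThanHalf : F ≢ [] → (∀ y → AtLeastHalf y F → y ≡ x) →
  ∀ z → MoreThanHalf z (extend M F) → z ≡ suc x
extend-onlyMoreThanHalf {M = M} F≢[] only zero more =
  contradiction more (¬moreThanHalf-zero-extend {M = M} F≢[])
extend-onlyMoreThanHalf {F = F} {M = M} F≢[] only (suc y) more =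
  cong suc (only y (moreThanHalf-extend⇒atLeastHalf {y = y} {M = M} {F = F} more))

c1⇒c1' : C1 → C1'
c1⇒c1' c1 n F fam uc F≢⊥∷[] with ⊥∈F? F
... | no ⊥∉F = map₂ <⇒≤ (c1 n F fam uc ⊥∉F)
... | yes ⊥∈F with A , A∈F , A≢⊥ ← nonEmptyMember fam F≢⊥∷[] =
  map₂ (Equivalence.from (atLeastHalf⇔moreThanHalf-dropEmpty (proj₁ fam) ⊥∈F _))
    (c1 n (dropEmpty F) (dropEmpty-isFamily fam A∈F A≢⊥) (dropEmpty-unionClosed uc)
      (⊥∉dropEmpty {F = F}))

c1'⇒c1 : C1' → C1
c1'⇒c1 c1' n F fam uc ⊥∉F =
  map₂ (Equivalence.to (atLeastHalf-⊥∷⇔moreThanHalf _ F))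
    (c1' n (⊥ ∷ F) (⊥∷-isFamily fam ⊥∉F) (⊥∷-unionClosed uc) (λ { refl → proj₂ fam refl }))

c2⇒c2' : C2 → C2'
c2⇒c2' c2 n F fam uc x half only A A∈F A≢⊥ with ⊥∈F? F
... | yes ⊥∈F =
  c2 n (dropEmpty F) (dropEmpty-isFamily fam A∈F A≢⊥) (dropEmpty-unionClosed uc) (⊥∉dropEmpty {F = F})
     x (Equivalence.to (halves x) half) (λ y → only y ∘ Equivalence.from (halves y))
     A (∈-dropEmpty⁺ A∈F A≢⊥)
  where
  halves : ∀ y → AtLeastHalf y F ⇔ MoreThanHalf y (dropEmpty F)
  halves = atLeastHalf⇔moreThanHalf-dropEmpty (proj₁ fam) ⊥∈F
... | no ⊥∉F =
  drop-there (c2 (suc n) (extend ⊤ F) (extend-isFamily (proj₁ fam)) (extend-unionClosed uc (λ _ _ → ⊆⊤))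
    (⊥∉extend ⊥∉F) (suc x) (atLeastHalf⇒moreThanHalf-extend {F = F} ∈⊤ half)
    (extend-onlyMoreThanHalf (proj₂ fam) only)
    (outside ∷ A) (∈-extend⁺ A∈F))

c2'⇒c2 : C2' → C2
c2'⇒c2 c2' n F fam uc ⊥∉F x more only A A∈F =
  c2' n (⊥ ∷ F) (⊥∷-isFamily fam ⊥∉F) (⊥∷-unionClosed uc) x (Equivalence.from (halves x) more)
    (λ y → only y ∘ Equivalence.to (halves y)) A (there A∈F) (λ { refl → ⊥∉F A∈F })
  where
  halves : ∀ y → AtLeastHalf y (⊥ ∷ F) ⇔ MoreThanHalf y F
  halves y = atLeastHalf-⊥∷⇔moreThanHalf y F

c3⇒c3' : C3 → C3'
c3⇒c3' c3 n F fam uc M largest separating x half only with ⊥∈F? F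
... | yes ⊥∈F =
  (λ _ → dropEmpty-enumerates⁻ ⊥∈F characterised) ,
  (λ ∣M∣≡1 → inj₂ (dropEmpty-enumerates⁻ ⊥∈F (λ A → principal⇔≡⁅x⁆ ∣M∣≡1 x∈M ⇔-∘ characterised A)))
  where
  x∈M : x ∈ M
  x∈M = atLeastHalf⇒∈largest (proj₂ fam) largest half
  M≢⊥ : M ≢ ⊥
  M≢⊥ refl = ∉⊥ x∈M
  halves : ∀ y → AtLeastHalf y F ⇔ MoreThanHalf y (dropEmpty F)
  halves = atLeastHalf⇔moreThanHalf-dropEmpty (proj₁ fam) ⊥∈F
  characterised : Enumerates (dropEmpty F) (Principal M x)
  characterised =
    c3 n (dropEmpty F) (dropEmpty-isFamily fam (proj₁ largest) M≢⊥) (dropEmpty-unionClosed uc)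
      (pointSeparating⇒twinFree (proj₂ (dropEmpty-largest largest M≢⊥))
        (pointSeparating-mono ∈-dropEmpty⁺ separating))
      (⊥∉dropEmpty {F = F}) M (dropEmpty-largest largest M≢⊥)
      x (Equivalence.to (halves x) half) (λ y → only y ∘ Equivalence.from (halves y))
... | no ⊥∉F =
  (λ 2≤∣M∣ → contradiction (subst (2 ≤_) ∣M∣≡1 2≤∣M∣) λ { (s≤s ()) }) ,
  (λ _ → inj₁ λ A →
    mk⇔ (λ A∈F → trans (everySetIsM A∈F) M≡⁅x⁆) λ { refl → subst (_∈F F) M≡⁅x⁆ (proj₁ largest) })
  where
  x∈M : x ∈ M
  x∈M = atLeastHalf⇒∈largest (proj₂ fam) largest half
  cone : Enumerates (extend M F) (Principal (inside ∷ M) (suc x))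
  cone =
    c3 (suc n) (extend M F) (extend-isFamily (proj₁ fam)) (extend-unionClosed uc (proj₂ largest))
      (pointSeparating⇒twinFree (proj₂ (extend-largest (proj₂ largest)))
        (pointSeparating-extend (proj₁ largest) separating))
      (⊥∉extend ⊥∉F) (inside ∷ M) (extend-largest (proj₂ largest))
      (suc x) (atLeastHalf⇒moreThanHalf-extend {F = F} x∈M half)
      (extend-onlyMoreThanHalf (proj₂ fam) only)
  everySetIsM : ∀ {A} → A ∈F F → A ≡ M
  everySetIsM = extend-principal⇒≡ cone
  onlyElement : ∀ {y} → y ∈ M → y ≡ x
  onlyElement y∈M =
    only _ (∈-all⇒atLeastHalf (All.tabulate λ A∈F → subst (_ ∈_) (sym (everySetIsM A∈F)) y∈M))
  M≡⁅x⁆ : M ≡ ⁅ x ⁆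
  M≡⁅x⁆ = ⊆-antisym (Equivalence.from x∈⁅y⁆⇔x≡y ∘ onlyElement) (x∈p⇒⁅x⁆⊆p x∈M)
  ∣M∣≡1 : ∣ M ∣ ≡ 1
  ∣M∣≡1 = trans (cong ∣_∣ M≡⁅x⁆) (∣⁅x⁆∣≡1 x)

c3'⇒c3 : C3' → C3
c3'⇒c3 c3' n F fam uc twinFree ⊥∉F M largest x more only = byCardinality ∣ M ∣ refl
  where
  x∈M : x ∈ M
  x∈M = atLeastHalf⇒∈largest (proj₂ fam) largest (<⇒≤ more)
  halves : ∀ y → AtLeastHalf y (⊥ ∷ F) ⇔ MoreThanHalf y F
  halves y = atLeastHalf-⊥∷⇔moreThanHalf y F
  characterised :
    (2 ≤ ∣ M ∣ → Enumerates (⊥ ∷ F) (λ A → A ≡ ⊥ ⊎ Principal M x A)) ×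
    (∣ M ∣ ≡ 1 → Enumerates (⊥ ∷ F) (_≡ ⁅ x ⁆) ⊎ Enumerates (⊥ ∷ F) (λ A → A ≡ ⊥ ⊎ A ≡ ⁅ x ⁆))
  characterised =
    c3' n (⊥ ∷ F) (⊥∷-isFamily fam ⊥∉F) (⊥∷-unionClosed uc) M (⊥∷-largest largest)
      (pointSeparating-mono (λ A∈F _ → there A∈F) (twinFree⇒pointSeparating (proj₁ largest) twinFree))
      x (Equivalence.from (halves x) more) (λ y → only y ∘ Equivalence.to (halves y))
  byCardinality : ∀ k → ∣ M ∣ ≡ k → Enumerates F (Principal M x)
  byCardinality zero ∣M∣≡0 = contradiction (subst (0 <_) ∣M∣≡0 (x∈p⇒0<∣p∣ x∈M)) λ ()
  byCardinality (suc zero) ∣M∣≡1 with proj₂ characterised ∣M∣≡1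
  ... | inj₁ ⊥∷F≐⁅x⁆ = contradiction (Equivalence.to (⊥∷F≐⁅x⁆ ⊥) (here refl)) ⊥≢⁅x⁆
  ... | inj₂ ⊥∷F≐⊥,⁅x⁆ = λ A →
    ⇔-sym (principal⇔≡⁅x⁆ ∣M∣≡1 x∈M) ⇔-∘ ⊥∷-enumerates⁻ ⊥∉F ⊥≢⁅x⁆ ⊥∷F≐⊥,⁅x⁆ A
  byCardinality (suc (suc k)) ∣M∣≡2+k =
    ⊥∷-enumerates⁻ ⊥∉F (∉⊥ ∘ proj₂) (proj₁ characterised (subst (2 ≤_) (sym ∣M∣≡2+k) (s≤s (s≤s z≤n))))

map-distinctPair : {P Q : Fin n → Set} → (∀ {y} → P y → Q y) →
  ∃[ a ] ∃[ b ] (a ≢ b × P a × P b) → ∃[ a ] ∃[ b ] (a ≢ b × Q a × Q b)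
map-distinctPair P⇒Q (a , b , a≢b , Pa , Pb) = a , b , a≢b , P⇒Q Pa , P⇒Q Pb

c4⇒c4' : C4 → C4'
c4⇒c4' c4 n F fam uc F≢⊥∷[] large with ⊥∈F? F
... | no ⊥∉F = map-distinctPair <⇒≤ (c4 n F fam uc (λ A A∈F → large A A∈F (λ { refl → ⊥∉F A∈F })))
... | yes ⊥∈F with A , A∈F , A≢⊥ ← nonEmptyMember fam F≢⊥∷[] =
  map-distinctPair (Equivalence.from (atLeastHalf⇔moreThanHalf-dropEmpty (proj₁ fam) ⊥∈F _))
    (c4 n (dropEmpty F) (dropEmpty-isFamily fam A∈F A≢⊥) (dropEmpty-unionClosed uc)
      (λ B B∈ → uncurry (large B) (∈-dropEmpty⁻ {F = F} B∈)))

c4'⇒c4 : C4' → C4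
c4'⇒c4 c4' n F fam uc large =
  map-distinctPair (Equivalence.to (atLeastHalf-⊥∷⇔moreThanHalf _ F))
    (c4' n (⊥ ∷ F) (⊥∷-isFamily fam ⊥∉F) (⊥∷-unionClosed uc) (λ { refl → proj₂ fam refl }) large⊥)
  where
  ⊥∉F : ⊥ ∉F F
  ⊥∉F ⊥∈F = contradiction (subst (2 ≤_) (∣⊥∣≡0 n) (large ⊥ ⊥∈F)) λ ()
  large⊥ : ∀ A → A ∈F (⊥ ∷ F) → A ≢ ⊥ → 2 ≤ ∣ A ∣
  large⊥ A (here refl) A≢⊥ = contradiction refl A≢⊥
  large⊥ A (there A∈F) _ = large A A∈F

proposition5 : (C1 ⇔ C1') × (C2 ⇔ C2') × (C3 ⇔ C3') × (C4 ⇔ C4')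
proposition5 = mk⇔ c1⇒c1' c1'⇒c1 , mk⇔ c2⇒c2' c2'⇒c2 , mk⇔ c3⇒c3' c3'⇒c3 , mk⇔ c4⇒c4' c4'⇒c4
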